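{- Let $n,k$ be integers with $k\ge1$ and $n\ge k+1$. Then \[ p_1N_{n-1,k}+p_2N_{n-2,k}+\dots+p_{n-k}N_{k,k}=(n-k)N_{n,k}+(k+1)N_{n,k+1}. \]
   Context: $\mathrm{Sym}$ is the algebra of symmetric functions, viewed as the subring of $\mathbb{Q}[[x_1,x_2,\dots]]$ of bounded-degree formal power series invariant under permutations of the variables. $p_j=\sum_i x_i^j$ is the power-sum symmetric function. For positive integers $n,k$, $N_{n,k}$ is the sum of all monomial symmetric functions $m_\lambda$ over partitions $\lambda$ of $n$ having exactly $k$ parts (so $N_{n,k}=0$ if $k>n$). -}

module Defs where

open import Data.Nat using (ℕ; zero; suc; _∸_; _⊓_; _≡ᵇ_)
open import Data.Integer as ℤ using (ℤ; +_)
open import Data.List using (List; []; _∷_; [_]; map; concatMap; upTo; foldr)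
open import Data.Bool using (Bool; true; false; if_then_else_; not; _∧_)
open import Data.Nat using (_≤ᵇ_)
open import Data.Product using (_×_; _,_)

-- Formal power series in x₁, x₂, … with integer coefficients.
-- A monomial x^α is given by its exponent vector α = (α₁, α₂, …, αᵣ),
-- with all further exponents 0 (trailing zeros are immaterial).
Monomial : Set
Monomial = List ℕ

Series : Set
Series = Monomial → ℤ

_≈S_ : Series → Series → Set
f ≈S g = (α : Monomial) → f α ≡ g α
  where open import Relation.Binary.PropositionalEquality using (_≡_)

infixl 6 _⊕_
infixl 7 _⊗_ _·_

zeroS : Series
zeroS _ = + 0

_⊕_ : Series → Series → Series
(f ⊕ g) α = f α ℤ.+ g α

_·_ : ℤ → Series → Series
(c · f) α = c ℤ.* f α

sumℤ : List ℤ → ℤ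
sumℤ = foldr ℤ._+_ (+ 0)

sumS : List Series → Series
sumS = foldr _⊕_ zeroS

splits : Monomial → List (Monomial × Monomial)
splits [] = [ ([] , []) ]
splits (a ∷ α) =
  concatMap (λ i → map (λ { (β , γ) → (i ∷ β , (a ∸ i) ∷ γ) }) (splits α)) (upTo (suc a))

_⊗_ : Series → Series → Series
(f ⊗ g) α = sumℤ (map (λ { (β , γ) → f β ℤ.* g γ }) (splits α))

indicator : Bool → ℤ
indicator true = + 1
indicator false = + 0

nonzeros : List ℕ → List ℕ
nonzeros [] = []
nonzeros (a ∷ α) = if a ≡ᵇ 0 then nonzeros α else a ∷ nonzeros α

insertDesc : ℕ → List ℕ → List ℕ
insertDesc a [] = [ a ]
insertDesc a (b ∷ bs) = if b ≤ᵇ a then a ∷ b ∷ bs else b ∷ insertDesc a bs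

sortDesc : List ℕ → List ℕ
sortDesc = foldr insertDesc []

eqList : List ℕ → List ℕ → Bool
eqList [] [] = true
eqList [] (_ ∷ _) = false
eqList (_ ∷ _) [] = false
eqList (a ∷ as) (b ∷ bs) = (a ≡ᵇ b) ∧ eqList as bs

-- Partitions (weakly decreasing lists of positive integers) of n with exactly
-- k parts, all parts ≤ b.
partitionsB : ℕ → ℕ → ℕ → List (List ℕ)
partitionsB n zero b = if n ≡ᵇ 0 then [ [] ] else []
partitionsB n (suc k) b =
  concatMap (λ i → map (i ∷_) (partitionsB (n ∸ i) k i)) (map suc (upTo (b ⊓ n)))

partitions : ℕ → ℕ → List (List ℕ)
partitions n k = partitionsB n k n

-- monomial symmetric function m_λ (λ a partition): the sum of all distinct
-- monomials x^α whose nonzero exponents are a rearrangement of λ.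
m : List ℕ → Series
m λ′ α = indicator (eqList (sortDesc (nonzeros α)) λ′)

-- power sum p_j = Σ_i x_i^j  (used for j ≥ 1)
p : ℕ → Series
p j α = indicator (eqList (nonzeros α) [ j ])

N : ℕ → ℕ → Series
N n k = sumS (map m (partitions n k))

lhs8 : ℕ → ℕ → Series
lhs8 n k = sumS (map (λ i → p (suc i) ⊗ N (n ∸ suc i) k) (upTo (n ∸ k)))

module Submission where

-- The identity is checked coefficientwise.  For a monomial x^α write deg α
-- for its degree and len α for its number of nonzero exponents.
--  (1) [x^α] N_{n,k} = [len α = k ∧ deg α = n]: sorting the nonzero exponents
--      of α gives a partition, and it is enumerated exactly once by
--      `partitions n k` iff it has k parts and size n.
--  (2) [x^α] (p_j g) = Σ_r [α_r ≥ j] g(α - j e_r): the sum `lowerSum` over the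
--      ways to lower one exponent by j.
--  (3) For g = N_{n-j,k}, lowering α_r by j keeps len α if α_r > j and drops it
--      by one if α_r = j, so [x^α](p_j N_{n-j,k}) is
--      #{r : α_r > j}·[len α = k, deg α = n] + #{r : α_r = j}·[len α = k+1, deg α = n].
--  (4) Summing over j = 1 … n-k: if len α = k and deg α = n then every
--      α_r - 1 ≤ n-k, so Σ_j #{r : α_r > j} = Σ_r (α_r - 1) = n - k; if
--      len α = k+1 and deg α = n then every nonzero α_r ≤ n-k, so
--      Σ_j #{r : α_r = j} = len α = k + 1.
-- The file follows this outline: finite sums and booleans; sorting and the
-- partition count giving (1); products with p_j, `lowerSum` and its closed
-- form giving (2) and (3); the sums over j giving (4); and finally the theorem,
-- which multiplies out (3) summed over j and simplifies with (4) and (1).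

open import Defs
open import Data.Nat as ℕ using (ℕ; zero; suc; _+_; _∸_; _⊓_; _≡ᵇ_; _≤ᵇ_; _<ᵇ_; _≤_; _<_; z≤n; s≤s)
import Data.Nat.Properties as ℕP
open import Data.Nat.ListAction using (sum)
open import Data.Nat.Tactic.RingSolver using (solve-∀)
open import Data.Integer as ℤ using (ℤ; +_) renaming (_+_ to _+ℤ_; _*_ to _*ℤ_)
import Data.Integer.Properties as ℤP
import Data.Integer.Tactic.RingSolver as ℤSolver
open import Data.List using (List; []; _∷_; map; concatMap; upTo; applyUpTo; _++_; length)
import Data.List.Properties as LP
open import Data.Bool using (Bool; true; false; if_then_else_; _∧_; T)
import Data.Bool.Properties as BP
open import Data.Product using (_×_; _,_; proj₁; proj₂)
open import Data.Unit using (tt)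
open import Data.Empty using (⊥-elim)
open import Function using (_∘_)
open import Relation.Nullary using (¬_; yes; no)
open import Relation.Binary.Definitions using (tri<; tri≈; tri>)
open import Relation.Binary.PropositionalEquality
open ≡-Reasoning

sumℤ-++ : ∀ xs ys → sumℤ (xs ++ ys) ≡ sumℤ xs +ℤ sumℤ ys
sumℤ-++ []       ys = sym (ℤP.+-identityˡ _)
sumℤ-++ (x ∷ xs) ys = trans (cong (x +ℤ_) (sumℤ-++ xs ys)) (sym (ℤP.+-assoc x _ _))

sumℤ-map-∘ : ∀ {A B : Set} (F : B → ℤ) (g : A → B) xs →
  sumℤ (map F (map g xs)) ≡ sumℤ (map (F ∘ g) xs)
sumℤ-map-∘ F g xs = cong sumℤ (sym (LP.map-∘ xs))

sumℤ-zero : ∀ {A : Set} (f : A → ℤ) → (∀ x → f x ≡ + 0) → ∀ xs → sumℤ (map f xs) ≡ + 0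
sumℤ-zero f f≗0 []       = refl
sumℤ-zero f f≗0 (x ∷ xs) rewrite f≗0 x | sumℤ-zero f f≗0 xs = refl

sumℤ-concatMap : ∀ {A B : Set} (F : B → ℤ) (G : A → List B) xs →
  sumℤ (map F (concatMap G xs)) ≡ sumℤ (map (λ x → sumℤ (map F (G x))) xs)
sumℤ-concatMap F G []       = refl
sumℤ-concatMap F G (x ∷ xs) = begin
  sumℤ (map F (G x ++ concatMap G xs))
    ≡⟨ cong sumℤ (LP.map-++ F (G x) (concatMap G xs)) ⟩
  sumℤ (map F (G x) ++ map F (concatMap G xs))
    ≡⟨ sumℤ-++ (map F (G x)) _ ⟩
  sumℤ (map F (G x)) +ℤ sumℤ (map F (concatMap G xs))
    ≡⟨ cong (sumℤ (map F (G x)) +ℤ_) (sumℤ-concatMap F G xs) ⟩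
  sumℤ (map F (G x)) +ℤ sumℤ (map (λ x → sumℤ (map F (G x))) xs) ∎

Σℤ : ℕ → (ℕ → ℤ) → ℤ
Σℤ zero    f = + 0
Σℤ (suc M) f = f 0 +ℤ Σℤ M (f ∘ suc)

Σℕ : ℕ → (ℕ → ℕ) → ℕ
Σℕ zero    f = 0
Σℕ (suc M) f = f 0 + Σℕ M (f ∘ suc)

sumℤ-applyUpTo : ∀ (f : ℕ → ℤ) M → sumℤ (applyUpTo f M) ≡ Σℤ M f
sumℤ-applyUpTo f zero    = refl
sumℤ-applyUpTo f (suc M) = cong (f 0 +ℤ_) (sumℤ-applyUpTo (f ∘ suc) M)

sumℤ-upTo : ∀ (f : ℕ → ℤ) M → sumℤ (map f (upTo M)) ≡ Σℤ M f
sumℤ-upTo f M = trans (cong sumℤ (LP.map-upTo f M)) (sumℤ-applyUpTo f M)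

Σℤ-cong< : ∀ M {f g : ℕ → ℤ} → (∀ i → i < M → f i ≡ g i) → Σℤ M f ≡ Σℤ M g
Σℤ-cong< zero    f≗g = refl
Σℤ-cong< (suc M) f≗g =
  cong₂ _+ℤ_ (f≗g 0 (s≤s z≤n)) (Σℤ-cong< M (λ i i<M → f≗g (suc i) (s≤s i<M)))

Σℤ-zero : ∀ M → Σℤ M (λ _ → + 0) ≡ + 0
Σℤ-zero zero    = refl
Σℤ-zero (suc M) = trans (ℤP.+-identityˡ _) (Σℤ-zero M)

Σℤ-delta : ∀ M x (f : ℕ → ℤ) →
  Σℤ M (λ i → if x ≡ᵇ i then f i else + 0) ≡ (if x <ᵇ M then f x else + 0)
Σℤ-delta zero    x       f = refl
Σℤ-delta (suc M) zero    f = trans (cong (f 0 +ℤ_) (Σℤ-zero M)) (ℤP.+-identityʳ _)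
Σℤ-delta (suc M) (suc x) f = trans (ℤP.+-identityˡ _) (Σℤ-delta M x (f ∘ suc))

Σℕ-zero : ∀ M → Σℕ M (λ _ → 0) ≡ 0
Σℕ-zero zero    = refl
Σℕ-zero (suc M) = Σℕ-zero M

Σℕ-+ : ∀ M (f g : ℕ → ℕ) → Σℕ M (λ i → f i + g i) ≡ Σℕ M f + Σℕ M g
Σℕ-+ zero    f g = refl
Σℕ-+ (suc M) f g = begin
  (f 0 + g 0) + Σℕ M (λ i → f (suc i) + g (suc i))
    ≡⟨ cong (λ v → (f 0 + g 0) + v) (Σℕ-+ M (f ∘ suc) (g ∘ suc)) ⟩
  (f 0 + g 0) + (Σℕ M (f ∘ suc) + Σℕ M (g ∘ suc))
    ≡⟨ interchange (f 0) (g 0) _ _ ⟩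
  (f 0 + Σℕ M (f ∘ suc)) + (g 0 + Σℕ M (g ∘ suc)) ∎
  where
  interchange : ∀ a b c d → (a + b) + (c + d) ≡ (a + c) + (b + d)
  interchange = solve-∀

combine : ∀ a b c d (X Y : ℤ) →
  ((+ a) *ℤ X +ℤ (+ b) *ℤ Y) +ℤ ((+ c) *ℤ X +ℤ (+ d) *ℤ Y)
  ≡ (+ (a + c)) *ℤ X +ℤ (+ (b + d)) *ℤ Y
combine a b c d X Y = begin
  ((+ a) *ℤ X +ℤ (+ b) *ℤ Y) +ℤ ((+ c) *ℤ X +ℤ (+ d) *ℤ Y)
    ≡⟨ collect (+ a) (+ b) (+ c) (+ d) X Y ⟩
  ((+ a) +ℤ (+ c)) *ℤ X +ℤ ((+ b) +ℤ (+ d)) *ℤ Y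
    ≡⟨ sym (cong₂ (λ u v → u *ℤ X +ℤ v *ℤ Y) (ℤP.pos-+ a c) (ℤP.pos-+ b d)) ⟩
  (+ (a + c)) *ℤ X +ℤ (+ (b + d)) *ℤ Y ∎
  where
  collect : ∀ (a b c d X Y : ℤ) → (a *ℤ X +ℤ b *ℤ Y) +ℤ (c *ℤ X +ℤ d *ℤ Y)
                                  ≡ (a +ℤ c) *ℤ X +ℤ (b +ℤ d) *ℤ Y
  collect = ℤSolver.solve-∀

Σℤ-linear : ∀ M (f g : ℕ → ℕ) X Y →
  Σℤ M (λ i → (+ f i) *ℤ X +ℤ (+ g i) *ℤ Y) ≡ (+ Σℕ M f) *ℤ X +ℤ (+ Σℕ M g) *ℤ Y
Σℤ-linear zero    f g X Y = refl
Σℤ-linear (suc M) f g X Y =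
  trans (cong ((+ f 0) *ℤ X +ℤ (+ g 0) *ℤ Y +ℤ_) (Σℤ-linear M (f ∘ suc) (g ∘ suc) X Y))
        (combine (f 0) (g 0) (Σℕ M (f ∘ suc)) (Σℕ M (g ∘ suc)) X Y)

sumS-coeff : ∀ (fs : List Series) α → sumS fs α ≡ sumℤ (map (λ f → f α) fs)
sumS-coeff []       α = refl
sumS-coeff (f ∷ fs) α = cong (f α +ℤ_) (sumS-coeff fs α)

sumS-upTo-coeff : ∀ (F : ℕ → Series) M α → sumS (map F (upTo M)) α ≡ Σℤ M (λ i → F i α)
sumS-upTo-coeff F M α = begin
  sumS (map F (upTo M)) α                    ≡⟨ sumS-coeff (map F (upTo M)) α ⟩
  sumℤ (map (λ f → f α) (map F (upTo M)))    ≡⟨ sumℤ-map-∘ (λ f → f α) F (upTo M) ⟩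
  sumℤ (map (λ i → F i α) (upTo M))          ≡⟨ sumℤ-upTo (λ i → F i α) M ⟩
  Σℤ M (λ i → F i α)                         ∎

T⇒≡true : ∀ {b} → T b → b ≡ true
T⇒≡true {true} _ = refl

¬T⇒≡false : ∀ {b} → ¬ T b → b ≡ false
¬T⇒≡false {true}  ¬t = ⊥-elim (¬t tt)
¬T⇒≡false {false} _  = refl

≡true⇒T : ∀ {b} → b ≡ true → T b
≡true⇒T refl = tt

≡ᵇ-true : ∀ {a b} → a ≡ b → (a ≡ᵇ b) ≡ true
≡ᵇ-true {a} {b} a≡b = T⇒≡true (ℕP.≡⇒≡ᵇ a b a≡b)

≡ᵇ-false : ∀ {a b} → ¬ a ≡ b → (a ≡ᵇ b) ≡ false
≡ᵇ-false {a} {b} a≢b = ¬T⇒≡false (λ t → a≢b (ℕP.≡ᵇ⇒≡ a b t))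

≡ᵇ-sym : ∀ a b → (a ≡ᵇ b) ≡ (b ≡ᵇ a)
≡ᵇ-sym zero    zero    = refl
≡ᵇ-sym zero    (suc b) = refl
≡ᵇ-sym (suc a) zero    = refl
≡ᵇ-sym (suc a) (suc b) = ≡ᵇ-sym a b

<ᵇ-true : ∀ {a b} → a < b → (a <ᵇ b) ≡ true
<ᵇ-true a<b = T⇒≡true (ℕP.<⇒<ᵇ a<b)

<ᵇ-false : ∀ {a b} → ¬ a < b → (a <ᵇ b) ≡ false
<ᵇ-false {a} {b} a≮b = ¬T⇒≡false (λ t → a≮b (ℕP.<ᵇ⇒< a b t))

≡ᵇ-∸ : ∀ x t n → x ≤ n → (t ≡ᵇ n ∸ x) ≡ (x + t ≡ᵇ n)
≡ᵇ-∸ zero    t n       _         = refl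
≡ᵇ-∸ (suc x) t (suc n) (s≤s x≤n) = ≡ᵇ-∸ x t n x≤n

deg : Monomial → ℕ
deg = sum

len : Monomial → ℕ
len α = length (nonzeros α)

isPos : ℕ → ℕ
isPos a = if a ≡ᵇ 0 then 0 else 1

len-∷ : ∀ a γ → len (a ∷ γ) ≡ isPos a + len γ
len-∷ zero    γ = refl
len-∷ (suc a) γ = refl

headAtMost : ℕ → List ℕ → Bool
headAtMost b []      = true
headAtMost b (x ∷ _) = x ≤ᵇ b

data Decreasing : List ℕ → Set where
  []  : Decreasing []
  _∷_ : ∀ {x xs} → T (headAtMost x xs) → Decreasing xs → Decreasing (x ∷ xs)

data Positive : List ℕ → Set where
  []  : Positive []
  _∷_ : ∀ x {xs} → Positive xs → Positive (suc x ∷ xs)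

insertDesc-headAtMost : ∀ a b xs → a ≤ b → T (headAtMost b xs) →
  T (headAtMost b (insertDesc a xs))
insertDesc-headAtMost a b []       a≤b _ = ℕP.≤⇒≤ᵇ a≤b
insertDesc-headAtMost a b (c ∷ cs) a≤b h with c ≤ᵇ a
... | true  = ℕP.≤⇒≤ᵇ a≤b
... | false = h

insertDesc-decreasing : ∀ a xs → Decreasing xs → Decreasing (insertDesc a xs)
insertDesc-decreasing a []       d = tt ∷ d
insertDesc-decreasing a (b ∷ bs) (h ∷ d) with b ≤ᵇ a in b≤ᵇa
... | true  = ≡true⇒T b≤ᵇa ∷ (h ∷ d)
... | false = insertDesc-headAtMost a b bs a≤b h ∷ insertDesc-decreasing a bs d
  where
  a≤b : a ≤ b
  a≤b = ℕP.<⇒≤ (ℕP.≰⇒> (λ b≤a → subst T b≤ᵇa (ℕP.≤⇒≤ᵇ b≤a)))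

insertDesc-positive : ∀ a xs → Positive xs → Positive (insertDesc (suc a) xs)
insertDesc-positive a []       _ = a ∷ []
insertDesc-positive a (b ∷ bs) (b′ ∷ ps) with b ≤ᵇ suc a
... | true  = a ∷ (b′ ∷ ps)
... | false = b′ ∷ insertDesc-positive a bs ps

insertDesc-sum : ∀ a xs → sum (insertDesc a xs) ≡ a + sum xs
insertDesc-sum a []       = refl
insertDesc-sum a (b ∷ bs) with b ≤ᵇ a
... | true  = refl
... | false = trans (cong (λ v → b + v) (insertDesc-sum a bs)) (swap a b (sum bs))
  where
  swap : ∀ a b c → b + (a + c) ≡ a + (b + c)
  swap = solve-∀

insertDesc-length : ∀ a xs → length (insertDesc a xs) ≡ suc (length xs)
insertDesc-length a []       = refl
insertDesc-length a (b ∷ bs) with b ≤ᵇ a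
... | true  = refl
... | false = cong suc (insertDesc-length a bs)

sortDesc-decreasing : ∀ xs → Decreasing (sortDesc xs)
sortDesc-decreasing []       = []
sortDesc-decreasing (x ∷ xs) = insertDesc-decreasing x (sortDesc xs) (sortDesc-decreasing xs)

sortDesc-positive : ∀ xs → Positive xs → Positive (sortDesc xs)
sortDesc-positive []            _        = []
sortDesc-positive (suc x ∷ xs) (_ ∷ ps) = insertDesc-positive x (sortDesc xs) (sortDesc-positive xs ps)

sortDesc-sum : ∀ xs → sum (sortDesc xs) ≡ sum xs
sortDesc-sum []       = refl
sortDesc-sum (x ∷ xs) = trans (insertDesc-sum x (sortDesc xs)) (cong (λ v → x + v) (sortDesc-sum xs))

sortDesc-length : ∀ xs → length (sortDesc xs) ≡ length xs
sortDesc-length []       = refl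
sortDesc-length (x ∷ xs) = trans (insertDesc-length x (sortDesc xs)) (cong suc (sortDesc-length xs))

nonzeros-positive : ∀ α → Positive (nonzeros α)
nonzeros-positive []          = []
nonzeros-positive (zero  ∷ α) = nonzeros-positive α
nonzeros-positive (suc a ∷ α) = a ∷ nonzeros-positive α

nonzeros-sum : ∀ α → sum (nonzeros α) ≡ deg α
nonzeros-sum []          = refl
nonzeros-sum (zero  ∷ α) = nonzeros-sum α
nonzeros-sum (suc a ∷ α) = cong (λ v → suc a + v) (nonzeros-sum α)

headAtMost-sum : ∀ s → T (headAtMost (sum s) s)
headAtMost-sum []      = tt
headAtMost-sum (x ∷ s) = ℕP.≤⇒≤ᵇ (ℕP.m≤m+n x (sum s))

-- The coefficients of N_{n,k}: counting partitions.

multiplicity : List ℕ → List (List ℕ) → ℤ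
multiplicity s ls = sumℤ (map (λ l → indicator (eqList s l)) ls)

multiplicity-prefixed : ∀ x i s ls →
  multiplicity (suc x ∷ s) (map (suc i ∷_) ls) ≡ (if x ≡ᵇ i then multiplicity s ls else + 0)
multiplicity-prefixed x i s ls with x ≡ᵇ i | sumℤ-map-∘ (λ l → indicator (eqList (suc x ∷ s) l)) (suc i ∷_) ls
... | true  | shift = shift
... | false | shift = trans shift (sumℤ-zero _ (λ _ → refl) ls)

-- `partitionsB n (k+1) b` lets the first part x+1 range over 1 … min(b, n);
-- this range condition equals conditions on the whole list (size n, head ≤ b).
firstPart-range : ∀ x t b n L →
  (if x <ᵇ b ⊓ n then indicator (L ∧ ((t ≡ᵇ n ∸ suc x) ∧ true)) else + 0)
  ≡ indicator (L ∧ ((suc (x + t) ≡ᵇ n) ∧ (x <ᵇ b)))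
firstPart-range x t b n L with x ℕ.<? b | x ℕ.<? n
... | yes x<b | yes x<n
  rewrite <ᵇ-true (ℕP.⊓-pres-m< x<b x<n) | <ᵇ-true x<b | BP.∧-identityʳ (t ≡ᵇ n ∸ suc x)
        | ≡ᵇ-∸ (suc x) t n x<n | BP.∧-identityʳ (suc (x + t) ≡ᵇ n) = refl
... | no x≮b | _
  rewrite <ᵇ-false (λ x<b⊓n → x≮b (ℕP.m<n⊓o⇒m<n b n x<b⊓n)) | <ᵇ-false x≮b
        | BP.∧-zeroʳ (suc (x + t) ≡ᵇ n) | BP.∧-zeroʳ L = refl
... | yes _ | no x≮n
  rewrite <ᵇ-false (λ x<b⊓n → x≮n (ℕP.m<n⊓o⇒m<o b n x<b⊓n))
        | ≡ᵇ-false {suc (x + t)} {n} (λ e → x≮n (subst (x <_) e (s≤s (ℕP.m≤m+n x t))))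
        | BP.∧-zeroʳ L = refl

partitionsB-multiplicity : ∀ k n b s → Decreasing s → Positive s →
  multiplicity s (partitionsB n k b) ≡ indicator ((length s ≡ᵇ k) ∧ ((sum s ≡ᵇ n) ∧ headAtMost b s))
partitionsB-multiplicity zero    zero    b []      _ _ = refl
partitionsB-multiplicity zero    (suc n) b []      _ _ = refl
partitionsB-multiplicity zero    zero    b (_ ∷ _) _ _ = refl
partitionsB-multiplicity zero    (suc n) b (_ ∷ _) _ _ = refl
partitionsB-multiplicity (suc k) n b [] _ _ =
  trans (sumℤ-concatMap _ (λ i → map (i ∷_) (partitionsB (n ∸ i) k i)) (map suc (upTo (b ⊓ n))))
        (sumℤ-zero _ (λ i → trans (sumℤ-map-∘ _ (i ∷_) (partitionsB (n ∸ i) k i))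
                                   (sumℤ-zero _ (λ _ → refl) (partitionsB (n ∸ i) k i)))
                    (map suc (upTo (b ⊓ n))))
partitionsB-multiplicity (suc k) n b (suc x ∷ s) (x≥s ∷ d) (_ ∷ ps) = begin
  multiplicity (suc x ∷ s) (partitionsB n (suc k) b)
    ≡⟨ sumℤ-concatMap _ prefixed (map suc (upTo (b ⊓ n))) ⟩
  sumℤ (map (λ i → multiplicity (suc x ∷ s) (prefixed i)) (map suc (upTo (b ⊓ n))))
    ≡⟨ sumℤ-map-∘ _ suc (upTo (b ⊓ n)) ⟩
  sumℤ (map (λ i → multiplicity (suc x ∷ s) (prefixed (suc i))) (upTo (b ⊓ n)))
    ≡⟨ sumℤ-upTo _ (b ⊓ n) ⟩
  Σℤ (b ⊓ n) (λ i → multiplicity (suc x ∷ s) (prefixed (suc i)))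
    ≡⟨ Σℤ-cong< (b ⊓ n) (λ i _ → multiplicity-prefixed x i s (rest i)) ⟩
  Σℤ (b ⊓ n) (λ i → if x ≡ᵇ i then multiplicity s (rest i) else + 0)
    ≡⟨ Σℤ-delta (b ⊓ n) x (λ i → multiplicity s (rest i)) ⟩
  (if x <ᵇ b ⊓ n then multiplicity s (rest x) else + 0)
    ≡⟨ cong (λ v → if x <ᵇ b ⊓ n then v else + 0) (partitionsB-multiplicity k (n ∸ suc x) (suc x) s d ps) ⟩
  (if x <ᵇ b ⊓ n then indicator ((length s ≡ᵇ k) ∧ ((sum s ≡ᵇ n ∸ suc x) ∧ headAtMost (suc x) s)) else + 0)
    ≡⟨ cong (λ v → if x <ᵇ b ⊓ n then indicator ((length s ≡ᵇ k) ∧ ((sum s ≡ᵇ n ∸ suc x) ∧ v)) else + 0)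
            (T⇒≡true x≥s) ⟩
  (if x <ᵇ b ⊓ n then indicator ((length s ≡ᵇ k) ∧ ((sum s ≡ᵇ n ∸ suc x) ∧ true)) else + 0)
    ≡⟨ firstPart-range x (sum s) b n (length s ≡ᵇ k) ⟩
  indicator ((length s ≡ᵇ k) ∧ ((suc (x + sum s) ≡ᵇ n) ∧ (x <ᵇ b))) ∎
  where
  prefixed : ℕ → List (List ℕ)
  prefixed i = map (i ∷_) (partitionsB (n ∸ i) k i)
  rest : ℕ → List (List ℕ)
  rest i = partitionsB (n ∸ suc i) k (suc i)

-- χ n k s l: the indicator that a monomial of degree s with l nonzero
-- exponents occurs in N_{n,k}.
χ : ℕ → ℕ → ℕ → ℕ → ℤ
χ n k s l = indicator ((l ≡ᵇ k) ∧ (s ≡ᵇ n))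

N-coeff : ∀ n k α → N n k α ≡ χ n k (deg α) (len α)
N-coeff n k α = begin
  N n k α
    ≡⟨ sumS-coeff (map m (partitions n k)) α ⟩
  sumℤ (map (λ f → f α) (map m (partitions n k)))
    ≡⟨ sumℤ-map-∘ _ m (partitions n k) ⟩
  multiplicity s (partitionsB n k n)
    ≡⟨ partitionsB-multiplicity k n n s (sortDesc-decreasing (nonzeros α))
                                        (sortDesc-positive (nonzeros α) (nonzeros-positive α)) ⟩
  indicator ((length s ≡ᵇ k) ∧ ((sum s ≡ᵇ n) ∧ headAtMost n s))
    ≡⟨ cong (λ v → indicator ((v ≡ᵇ k) ∧ ((sum s ≡ᵇ n) ∧ headAtMost n s))) (sortDesc-length (nonzeros α)) ⟩
  indicator ((len α ≡ᵇ k) ∧ ((sum s ≡ᵇ n) ∧ headAtMost n s))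
    ≡⟨ cong (λ v → indicator ((len α ≡ᵇ k) ∧ v)) size-condition ⟩
  χ n k (deg α) (len α) ∎
  where
  s = sortDesc (nonzeros α)
  sum-s : sum s ≡ deg α
  sum-s = trans (sortDesc-sum (nonzeros α)) (nonzeros-sum α)
  -- a partition of size n automatically has all parts ≤ n
  size-condition : ((sum s ≡ᵇ n) ∧ headAtMost n s) ≡ (deg α ≡ᵇ n)
  size-condition with sum s ℕ.≟ n
  ... | yes s≡n rewrite ≡ᵇ-true s≡n | ≡ᵇ-true (trans (sym sum-s) s≡n) =
    T⇒≡true (subst (λ v → T (headAtMost v s)) s≡n (headAtMost-sum s))
  ... | no s≢n rewrite ≡ᵇ-false s≢n | ≡ᵇ-false (λ e → s≢n (trans sum-s e)) = refl

-- Products with power sums.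

Σsplit : (Monomial → Monomial → ℤ) → Monomial → ℤ
Σsplit F α = sumℤ (map (λ q → F (proj₁ q) (proj₂ q)) (splits α))

Σsplit-∷ : ∀ F a α →
  Σsplit F (a ∷ α) ≡ Σℤ (suc a) (λ i → Σsplit (λ β γ → F (i ∷ β) ((a ∸ i) ∷ γ)) α)
Σsplit-∷ F a α = begin
  Σsplit F (a ∷ α)
    ≡⟨ sumℤ-concatMap F′ (λ i → map (prepend i) (splits α)) (upTo (suc a)) ⟩
  sumℤ (map (λ i → sumℤ (map F′ (map (prepend i) (splits α)))) (upTo (suc a)))
    ≡⟨ sumℤ-upTo (λ i → sumℤ (map F′ (map (prepend i) (splits α)))) (suc a) ⟩
  Σℤ (suc a) (λ i → sumℤ (map F′ (map (prepend i) (splits α))))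
    ≡⟨ Σℤ-cong< (suc a) (λ i _ → sumℤ-map-∘ F′ (prepend i) (splits α)) ⟩
  Σℤ (suc a) (λ i → Σsplit (λ β γ → F (i ∷ β) ((a ∸ i) ∷ γ)) α) ∎
  where
  F′ : Monomial × Monomial → ℤ
  F′ q = F (proj₁ q) (proj₂ q)
  prepend : ℕ → Monomial × Monomial → Monomial × Monomial
  prepend i q = (i ∷ proj₁ q , (a ∸ i) ∷ proj₂ q)

one : Series
one β = indicator (eqList (nonzeros β) [])

one-⊗ : ∀ (g : Series) α → (one ⊗ g) α ≡ g α
one-⊗ g []      = trans (ℤP.+-identityʳ _) (ℤP.*-identityˡ _)
one-⊗ g (a ∷ α) = begin
  (one ⊗ g) (a ∷ α)
    ≡⟨ Σsplit-∷ (λ β γ → one β *ℤ g γ) a α ⟩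
  (one ⊗ (λ γ → g (a ∷ γ))) α +ℤ Σℤ a (λ i → Σsplit (λ β γ → one (suc i ∷ β) *ℤ g ((a ∸ suc i) ∷ γ)) α)
    ≡⟨ cong₂ _+ℤ_ (one-⊗ (λ γ → g (a ∷ γ)) α)
                  (trans (Σℤ-cong< a (λ i _ → sumℤ-zero _ (λ _ → refl) (splits α))) (Σℤ-zero a)) ⟩
  g (a ∷ α) +ℤ + 0
    ≡⟨ ℤP.+-identityʳ _ ⟩
  g (a ∷ α) ∎

lowerSum : ℕ → Series → Monomial → ℤ
lowerSum j g []      = + 0
lowerSum j g (a ∷ α) = (if j ≤ᵇ a then g ((a ∸ j) ∷ α) else + 0) +ℤ lowerSum j (λ γ → g (a ∷ γ)) α

lowerSum-cong : ∀ j {g h : Series} → g ≈S h → ∀ α → lowerSum j g α ≡ lowerSum j h α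
lowerSum-cong j g≈h []      = refl
lowerSum-cong j g≈h (a ∷ α) =
  cong₂ _+ℤ_ (cong (λ v → if j ≤ᵇ a then v else + 0) (g≈h _)) (lowerSum-cong j (λ γ → g≈h (a ∷ γ)) α)

p⊗-coeff : ∀ j (g : Series) α → (p (suc j) ⊗ g) α ≡ lowerSum (suc j) g α
p⊗-coeff j g []      = refl
p⊗-coeff j g (a ∷ α) = begin
  (p (suc j) ⊗ g) (a ∷ α)
    ≡⟨ Σsplit-∷ (λ β γ → p (suc j) β *ℤ g γ) a α ⟩
  (p (suc j) ⊗ (λ γ → g (a ∷ γ))) α +ℤ Σℤ a (λ i → Σsplit (λ β γ → p (suc j) (suc i ∷ β) *ℤ g ((a ∸ suc i) ∷ γ)) α)
    ≡⟨ cong₂ _+ℤ_ (p⊗-coeff j (λ γ → g (a ∷ γ)) α) (Σℤ-cong< a (λ i _ → firstExponent i)) ⟩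
  lowerSum (suc j) (λ γ → g (a ∷ γ)) α +ℤ Σℤ a (λ i → if j ≡ᵇ i then g ((a ∸ suc i) ∷ α) else + 0)
    ≡⟨ cong (lowerSum (suc j) (λ γ → g (a ∷ γ)) α +ℤ_) (Σℤ-delta a j (λ i → g ((a ∸ suc i) ∷ α))) ⟩
  lowerSum (suc j) (λ γ → g (a ∷ γ)) α +ℤ (if j <ᵇ a then g ((a ∸ suc j) ∷ α) else + 0)
    ≡⟨ ℤP.+-comm (lowerSum (suc j) (λ γ → g (a ∷ γ)) α) _ ⟩
  lowerSum (suc j) g (a ∷ α) ∎
  where
  -- β = (i+1) ∷ β′ contributes only if i = j and β′ = 0, by the unit law
  firstExponent : ∀ i → Σsplit (λ β γ → p (suc j) (suc i ∷ β) *ℤ g ((a ∸ suc i) ∷ γ)) α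
                        ≡ (if j ≡ᵇ i then g ((a ∸ suc i) ∷ α) else + 0)
  firstExponent i rewrite ≡ᵇ-sym j i with i ≡ᵇ j
  ... | true  = one-⊗ (λ γ → g ((a ∸ suc i) ∷ γ)) α
  ... | false = sumℤ-zero _ (λ _ → refl) (splits α)

above equal : ℕ → ℕ → ℕ
above j a = if j <ᵇ a then 1 else 0
equal j a = if j ≡ᵇ a then 1 else 0

countAbove countEqual : ℕ → Monomial → ℕ
countAbove j []      = 0
countAbove j (a ∷ α) = above j a + countAbove j α
countEqual j []      = 0
countEqual j (a ∷ α) = equal j a + countEqual j α

-- Lowering the first exponent a by j+1, for a g depending only on degree and
-- length: the result keeps the length if a > j+1 and loses one if a = j+1.
lowerHead : ∀ j (ψ : ℕ → ℕ → ℤ) a α c z →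
  (if suc j ≤ᵇ a then ψ (suc j + (c + deg ((a ∸ suc j) ∷ α))) (z + len ((a ∸ suc j) ∷ α)) else + 0)
  ≡ (+ above (suc j) a) *ℤ ψ (c + deg (a ∷ α)) (z + len (a ∷ α))
    +ℤ (+ equal (suc j) a) *ℤ ψ (c + deg (a ∷ α)) (z + len (a ∷ α) ∸ 1)
lowerHead j ψ a α c z with ℕP.<-cmp (suc j) a
... | tri< j+1<a _ _
  rewrite <ᵇ-true {j} {a} (ℕP.<⇒≤ j+1<a) | <ᵇ-true j+1<a | ≡ᵇ-false (ℕP.<⇒≢ j+1<a)
  = trans (cong₂ ψ same-degree same-length) (sym (weights-1-0 (ψ (c + (a + deg α)) (z + len (a ∷ α))) (ψ (c + (a + deg α)) (z + len (a ∷ α) ∸ 1))))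
  where
  weights-1-0 : ∀ X Y → (+ 1) *ℤ X +ℤ (+ 0) *ℤ Y ≡ X
  weights-1-0 = ℤSolver.solve-∀
  same-degree : suc j + (c + ((a ∸ suc j) + deg α)) ≡ c + (a + deg α)
  same-degree = trans (regroup (suc j) c (a ∸ suc j) (deg α))
                      (cong (λ v → c + (v + deg α)) (ℕP.m+[n∸m]≡n (ℕP.<⇒≤ j+1<a)))
    where
    regroup : ∀ s c d e → s + (c + (d + e)) ≡ c + ((s + d) + e)
    regroup = solve-∀
  isPos-1 : ∀ x → 0 < x → isPos x ≡ 1
  isPos-1 (suc x) _ = refl
  same-length : z + len ((a ∸ suc j) ∷ α) ≡ z + len (a ∷ α)
  same-length = cong (λ v → z + v) (begin
    len ((a ∸ suc j) ∷ α)    ≡⟨ len-∷ (a ∸ suc j) α ⟩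
    isPos (a ∸ suc j) + len α ≡⟨ cong (_+ len α) (isPos-1 _ (ℕP.m<n⇒0<n∸m j+1<a)) ⟩
    1 + len α                 ≡⟨ cong (_+ len α) (sym (isPos-1 a (ℕP.<-trans (s≤s z≤n) j+1<a))) ⟩
    isPos a + len α           ≡⟨ sym (len-∷ a α) ⟩
    len (a ∷ α)               ∎)
... | tri≈ _ refl _
  rewrite <ᵇ-true (ℕP.n<1+n j) | <ᵇ-false (ℕP.n≮n j) | ≡ᵇ-true {j} refl | ℕP.n∸n≡0 j
  = trans (cong₂ ψ (swap c (suc j) (deg α)) (sym (cong (_∸ 1) (ℕP.+-suc z (len α)))))
          (sym (weights-0-1 (ψ (c + (suc j + deg α)) (z + suc (len α))) (ψ (c + (suc j + deg α)) (z + suc (len α) ∸ 1))))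
  where
  weights-0-1 : ∀ X Y → (+ 0) *ℤ X +ℤ (+ 1) *ℤ Y ≡ Y
  weights-0-1 = ℤSolver.solve-∀
  swap : ∀ a b c → b + (a + c) ≡ a + (b + c)
  swap = solve-∀
... | tri> _ _ a<j+1
  rewrite <ᵇ-false {j} {a} (λ j<a → ℕP.n≮n j (ℕP.<-≤-trans j<a (ℕP.≤-pred a<j+1)))
        | <ᵇ-false {suc j} {a} (λ j+1<a → ℕP.<-asym j+1<a a<j+1)
        | ≡ᵇ-false {suc j} {a} (λ e → ℕP.>⇒≢ a<j+1 e)
  = refl

-- The offsets c, z make the statement inductive in α.
lowerSum-closedForm : ∀ j (ψ : ℕ → ℕ → ℤ) α c z →
  lowerSum (suc j) (λ γ → ψ (suc j + (c + deg γ)) (z + len γ)) α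
  ≡ (+ countAbove (suc j) α) *ℤ ψ (c + deg α) (z + len α)
    +ℤ (+ countEqual (suc j) α) *ℤ ψ (c + deg α) (z + len α ∸ 1)
lowerSum-closedForm j ψ []      c z = refl
lowerSum-closedForm j ψ (a ∷ α) c z = begin
  head +ℤ lowerSum (suc j) (λ γ → ψ (suc j + (c + deg (a ∷ γ))) (z + len (a ∷ γ))) α
    ≡⟨ cong (head +ℤ_) (lowerSum-cong (suc j) shiftOffsets α) ⟩
  head +ℤ lowerSum (suc j) (λ γ → ψ (suc j + ((c + a) + deg γ)) ((z + isPos a) + len γ)) α
    ≡⟨ cong₂ _+ℤ_ (lowerHead j ψ a α c z) (lowerSum-closedForm j ψ α (c + a) (z + isPos a)) ⟩
  ((+ above (suc j) a) *ℤ X +ℤ (+ equal (suc j) a) *ℤ Y)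
    +ℤ ((+ countAbove (suc j) α) *ℤ ψ ((c + a) + deg α) ((z + isPos a) + len α)
        +ℤ (+ countEqual (suc j) α) *ℤ ψ ((c + a) + deg α) ((z + isPos a) + len α ∸ 1))
    ≡⟨ cong (((+ above (suc j) a) *ℤ X +ℤ (+ equal (suc j) a) *ℤ Y) +ℤ_)
            (cong₂ (λ u v → (+ countAbove (suc j) α) *ℤ u +ℤ (+ countEqual (suc j) α) *ℤ v)
                   (cong₂ ψ degree support) (cong₂ ψ degree (cong (_∸ 1) support))) ⟩
  ((+ above (suc j) a) *ℤ X +ℤ (+ equal (suc j) a) *ℤ Y)
    +ℤ ((+ countAbove (suc j) α) *ℤ X +ℤ (+ countEqual (suc j) α) *ℤ Y)
    ≡⟨ combine (above (suc j) a) (equal (suc j) a) (countAbove (suc j) α) (countEqual (suc j) α) X Y ⟩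
  (+ countAbove (suc j) (a ∷ α)) *ℤ X +ℤ (+ countEqual (suc j) (a ∷ α)) *ℤ Y ∎
  where
  head = if suc j ≤ᵇ a then ψ (suc j + (c + deg ((a ∸ suc j) ∷ α))) (z + len ((a ∸ suc j) ∷ α)) else + 0
  X = ψ (c + deg (a ∷ α)) (z + len (a ∷ α))
  Y = ψ (c + deg (a ∷ α)) (z + len (a ∷ α) ∸ 1)
  degree : (c + a) + deg α ≡ c + deg (a ∷ α)
  degree = ℕP.+-assoc c a (deg α)
  support : (z + isPos a) + len α ≡ z + len (a ∷ α)
  support = trans (ℕP.+-assoc z (isPos a) (len α)) (cong (λ v → z + v) (sym (len-∷ a α)))
  shiftOffsets : ∀ γ → ψ (suc j + (c + deg (a ∷ γ))) (z + len (a ∷ γ))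
                       ≡ ψ (suc j + ((c + a) + deg γ)) ((z + isPos a) + len γ)
  shiftOffsets γ = cong₂ ψ (cong (λ v → suc j + v) (sym (ℕP.+-assoc c a (deg γ))))
                           (trans (cong (λ v → z + v) (len-∷ a γ)) (sym (ℕP.+-assoc z (isPos a) (len γ))))

p⊗N-coeff : ∀ n k j α → suc j ≤ n →
  (p (suc j) ⊗ N (n ∸ suc j) k) α
  ≡ (+ countAbove (suc j) α) *ℤ χ n k (deg α) (len α) +ℤ (+ countEqual (suc j) α) *ℤ χ n k (deg α) (len α ∸ 1)
p⊗N-coeff n k j α j<n = begin
  (p (suc j) ⊗ N (n ∸ suc j) k) α
    ≡⟨ p⊗-coeff j (N (n ∸ suc j) k) α ⟩
  lowerSum (suc j) (N (n ∸ suc j) k) α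
    ≡⟨ lowerSum-cong (suc j) N-shifted α ⟩
  lowerSum (suc j) (λ γ → χ n k (suc j + deg γ) (len γ)) α
    ≡⟨ lowerSum-closedForm j (χ n k) α 0 0 ⟩
  (+ countAbove (suc j) α) *ℤ χ n k (deg α) (len α) +ℤ (+ countEqual (suc j) α) *ℤ χ n k (deg α) (len α ∸ 1) ∎
  where
  N-shifted : ∀ γ → N (n ∸ suc j) k γ ≡ χ n k (suc j + deg γ) (len γ)
  N-shifted γ = trans (N-coeff (n ∸ suc j) k γ)
                      (cong (λ v → indicator ((len γ ≡ᵇ k) ∧ v)) (≡ᵇ-∸ (suc j) (deg γ) n j<n))

-- Summing over j.

excess : Monomial → ℕ
excess []      = 0
excess (a ∷ α) = (a ∸ 1) + excess α

excess+len : ∀ α → excess α + len α ≡ deg α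
excess+len []          = refl
excess+len (zero  ∷ α) = excess+len α
excess+len (suc a ∷ α) =
  trans (regroup a (excess α) (len α)) (cong (λ v → suc (a + v)) (excess+len α))
  where
  regroup : ∀ a e l → (a + e) + suc l ≡ suc (a + (e + l))
  regroup = solve-∀

Σ-above : ∀ M a → Σℕ M (λ i → above i a) ≡ a ⊓ M
Σ-above zero    a       = sym (ℕP.⊓-zeroʳ a)
Σ-above (suc M) zero    = Σℕ-zero M
Σ-above (suc M) (suc a) = cong suc (Σ-above M a)

Σ-equal : ∀ M a → a < M → Σℕ M (λ i → equal i a) ≡ 1
Σ-equal (suc M) zero    _         = cong suc (Σℕ-zero M)
Σ-equal (suc M) (suc a) (s≤s a<M) = Σ-equal M a a<M

-- (4a) Σ_{j=1}^{M} #{r : α_r > j} = Σ_r min (α_r - 1, M) = excess α when excess α ≤ M.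
Σ-countAbove : ∀ M α → excess α ≤ M → Σℕ M (λ i → countAbove (suc i) α) ≡ excess α
Σ-countAbove M []      _ = Σℕ-zero M
Σ-countAbove M (a ∷ α) e≤M = begin
  Σℕ M (λ i → above (suc i) a + countAbove (suc i) α)
    ≡⟨ Σℕ-+ M (λ i → above (suc i) a) (λ i → countAbove (suc i) α) ⟩
  Σℕ M (λ i → above (suc i) a) + Σℕ M (λ i → countAbove (suc i) α)
    ≡⟨ cong₂ _+_ (first a e≤M) (Σ-countAbove M α (ℕP.m+n≤o⇒n≤o (a ∸ 1) e≤M)) ⟩
  (a ∸ 1) + excess α ∎
  where
  first : ∀ a → a ∸ 1 + excess α ≤ M → Σℕ M (λ i → above (suc i) a) ≡ a ∸ 1
  first zero    _   = Σℕ-zero M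
  first (suc a) a≤M = trans (Σ-above M a) (ℕP.m≤n⇒m⊓n≡m (ℕP.≤-trans (ℕP.m≤m+n a (excess α)) a≤M))

-- (4b) Σ_{j=1}^{M} #{r : α_r = j} = len α when every α_r ≤ M, i.e. when excess α < M.
Σ-countEqual : ∀ M α → excess α < M → Σℕ M (λ i → countEqual (suc i) α) ≡ len α
Σ-countEqual M []      _ = Σℕ-zero M
Σ-countEqual M (a ∷ α) e<M = begin
  Σℕ M (λ i → equal (suc i) a + countEqual (suc i) α)
    ≡⟨ Σℕ-+ M (λ i → equal (suc i) a) (λ i → countEqual (suc i) α) ⟩
  Σℕ M (λ i → equal (suc i) a) + Σℕ M (λ i → countEqual (suc i) α)
    ≡⟨ cong₂ _+_ (first a (ℕP.≤-<-trans (ℕP.m≤m+n (a ∸ 1) (excess α)) e<M))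
                 (Σ-countEqual M α (ℕP.≤-<-trans (ℕP.m≤n+m (excess α) (a ∸ 1)) e<M)) ⟩
  isPos a + len α
    ≡⟨ sym (len-∷ a α) ⟩
  len (a ∷ α) ∎
  where
  first : ∀ a → a ∸ 1 < M → Σℕ M (λ i → equal (suc i) a) ≡ isPos a
  first zero    _   = Σℕ-zero M
  first (suc a) a<M = Σ-equal M a a<M

Σ-countAbove-on-N : ∀ n k α → deg α ≡ n → len α ≡ k →
  Σℕ (n ∸ k) (λ i → countAbove (suc i) α) ≡ n ∸ k
Σ-countAbove-on-N n k α refl refl =
  trans (Σ-countAbove (deg α ∸ len α) α (ℕP.≤-reflexive excess≡)) excess≡
  where
  excess≡ : excess α ≡ deg α ∸ len α
  excess≡ = sym (trans (cong (_∸ len α) (sym (excess+len α))) (ℕP.m+n∸n≡m (excess α) (len α)))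

Σ-countEqual-on-N : ∀ n k α → deg α ≡ n → len α ≡ suc k →
  Σℕ (n ∸ k) (λ i → countEqual (suc i) α) ≡ suc k
Σ-countEqual-on-N n k α refl len≡ =
  trans (Σ-countEqual (deg α ∸ k) α (ℕP.≤-reflexive (sym M≡))) len≡
  where
  M≡ : deg α ∸ k ≡ suc (excess α)
  M≡ = begin
    deg α ∸ k                   ≡⟨ cong (_∸ k) (sym (excess+len α)) ⟩
    (excess α + len α) ∸ k      ≡⟨ cong (λ l → (excess α + l) ∸ k) len≡ ⟩
    (excess α + suc k) ∸ k      ≡⟨ cong (_∸ k) (ℕP.+-suc (excess α) k) ⟩
    (suc (excess α) + k) ∸ k    ≡⟨ ℕP.m+n∸n≡m (suc (excess α)) k ⟩
    suc (excess α)              ∎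

χ-reweight : ∀ n k s l a b → (s ≡ n → l ≡ k → a ≡ b) → (+ a) *ℤ χ n k s l ≡ (+ b) *ℤ χ n k s l
χ-reweight n k s l a b a≡b with l ℕ.≟ k | s ℕ.≟ n
... | yes l≡k | yes s≡n = cong (λ w → (+ w) *ℤ χ n k s l) (a≡b s≡n l≡k)
... | no l≢k  | _       rewrite ≡ᵇ-false l≢k = trans (ℤP.*-zeroʳ (+ a)) (sym (ℤP.*-zeroʳ (+ b)))
... | yes _   | no s≢n  rewrite ≡ᵇ-false s≢n | BP.∧-zeroʳ (l ≡ᵇ k) =
  trans (ℤP.*-zeroʳ (+ a)) (sym (ℤP.*-zeroʳ (+ b)))

χ-pred : ∀ n k s l → 1 ≤ k → χ n k s (l ∸ 1) ≡ χ n (suc k) s l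
χ-pred n (suc k) s zero    _ = refl
χ-pred n k       s (suc l) _ = refl

proposition8 : (n k : ℕ) → 1 ≤ k → suc k ≤ n →
    lhs8 n k ≈S ((+ (n ∸ k)) · N n k ⊕ (+ (suc k)) · N n (suc k))
proposition8 n k 1≤k k<n α = begin
  lhs8 n k α
    ≡⟨ sumS-upTo-coeff (λ i → p (suc i) ⊗ N (n ∸ suc i) k) M α ⟩
  Σℤ M (λ i → (p (suc i) ⊗ N (n ∸ suc i) k) α)
    ≡⟨ Σℤ-cong< M (λ i i<M → p⊗N-coeff n k i α (ℕP.≤-trans i<M (ℕP.m∸n≤m n k))) ⟩
  Σℤ M (λ i → (+ countAbove (suc i) α) *ℤ X +ℤ (+ countEqual (suc i) α) *ℤ Y)
    ≡⟨ Σℤ-linear M (λ i → countAbove (suc i) α) (λ i → countEqual (suc i) α) X Y ⟩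
  (+ A) *ℤ X +ℤ (+ E) *ℤ Y
    ≡⟨ cong (λ v → (+ A) *ℤ X +ℤ (+ E) *ℤ v) (χ-pred n k (deg α) (len α) 1≤k) ⟩
  (+ A) *ℤ X +ℤ (+ E) *ℤ X′
    ≡⟨ cong₂ _+ℤ_ (χ-reweight n k (deg α) (len α) A M (Σ-countAbove-on-N n k α))
                  (χ-reweight n (suc k) (deg α) (len α) E (suc k) (Σ-countEqual-on-N n k α)) ⟩
  (+ M) *ℤ X +ℤ (+ suc k) *ℤ X′
    ≡⟨ sym (cong₂ (λ u v → (+ M) *ℤ u +ℤ (+ suc k) *ℤ v) (N-coeff n k α) (N-coeff n (suc k) α)) ⟩
  (+ M) *ℤ N n k α +ℤ (+ suc k) *ℤ N n (suc k) α ∎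
  where
  M = n ∸ k
  A = Σℕ M (λ i → countAbove (suc i) α)
  E = Σℕ M (λ i → countEqual (suc i) α)
  X = χ n k (deg α) (len α)
  Y = χ n k (deg α) (len α ∸ 1)
  X′ = χ n (suc k) (deg α) (len α)
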